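{- Let $\overrightarrow{G}$ and $\overrightarrow{H}$ be oriented graphs and let $f: V(\overrightarrow{G})\to V(\overrightarrow{H})$ be a vertex mapping. Then $f$ is a pushable homomorphism of $\overrightarrow{G}$ to $\overrightarrow{H}$ if and only if $f$ preserves the directability of each ordered closed walk of $\overrightarrow{G}$.
   Context: An oriented graph is a directed graph with no loops whose underlying graph is simple (at most one arc between two vertices). To push a vertex $v$ means to reverse every arc incident to $v$; to push a set $S$ means to push each vertex of $S$ once; $\overrightarrow{G}'$ is push equivalent to $\overrightarrow{G}$ if it is obtained by pushing some vertex set. A homomorphism $\overrightarrow{G}\to\overrightarrow{H}$ is a vertex map $f$ with $f(u)f(v)\in A(\overrightarrow{H})$ for every arc $uv\in A(\overrightarrow{G})$. A pushable homomorphism of $\overrightarrow{G}$ to $\overrightarrow{H}$ is a vertex map $f$ such that $f$ is a homomorphism of some oriented graph push equivalent to $\overrightarrow{G}$ to $\overrightarrow{H}$. An ordered closed walk $C=v_1v_2\cdots v_kv_1$ is a closed walk with the traversal order $v_1\to\cdots\to v_k\to v_1$; an arc on it is forward if it is oriented $v_iv_{i+1}$ (indices mod $k$), backward otherwise. Its directability (type) is: odd forward directable ($k$ odd, odd number of forward arcs), odd backward directable ($k$ odd, even number of forward arcs), even directable ($k$ even, even number of forward arcs), or even non-directable ($k$ even, odd number of forward arcs). The map $f$ preserves the directability of the ordered closed walk $C$ of $\overrightarrow{G}$ if $f(C)=f(v_1)f(v_2)\cdots f(v_k)f(v_1)$ is an ordered closed walk of $\overrightarrow{H}$ and $C$ (oriented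 by $\overrightarrow{G}$) and $f(C)$ (oriented by $\overrightarrow{H}$) have the same directability. -}

module Defs where

open import Data.Nat using (ℕ; zero; suc; _+_)
open import Data.Bool using (Bool; true; false; if_then_else_; _xor_)
open import Data.Fin using (Fin; zero; suc; fromℕ; lower₁; toℕ)
open import Data.Fin.Properties using (_≟_)
open import Data.List using (List; map)
open import Data.Nat.ListAction using (sum)
open import Data.List using () renaming (allFin to allFinL)
open import Data.Product using (Σ; _×_; _,_)
open import Data.Sum using (_⊎_)
open import Relation.Nullary using (yes; no; ¬_)
open import Relation.Binary.PropositionalEquality using (_≡_; refl)

record OrientedGraph (n : ℕ) : Set where
  field
    arc   : Fin n → Fin n → Bool
    loopless : ∀ u → arc u u ≡ false
    simple   : ∀ u v → arc u v ≡ true → arc v u ≡ false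
open OrientedGraph public

pushArc : ∀ {n} → OrientedGraph n → (Fin n → Bool) → Fin n → Fin n → Bool
pushArc G S u v = if S u xor S v then arc G v u else arc G u v

IsHomArc : ∀ {n p} → (Fin n → Fin n → Bool) → OrientedGraph p → (Fin n → Fin p) → Set
IsHomArc A H f = ∀ u v → A u v ≡ true → arc H (f u) (f v) ≡ true

IsHomomorphism : ∀ {n p} → OrientedGraph n → OrientedGraph p → (Fin n → Fin p) → Set
IsHomomorphism G H f = IsHomArc (arc G) H f

-- f is a homomorphism of some oriented graph push equivalent to G (G pushed at S) to H
IsPushableHomomorphism : ∀ {n p} → OrientedGraph n → OrientedGraph p → (Fin n → Fin p) → Set
IsPushableHomomorphism G H f = Σ (Fin _ → Bool) λ S → IsHomArc (pushArc G S) H f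

-- cyclic successor on Fin (suc m): i ↦ i+1 (mod suc m)
next : ∀ {m} → Fin (suc m) → Fin (suc m)
next {m} i with i ≟ fromℕ m
... | yes _ = zero
... | no i≢last = lower₁ (suc i) λ eq → i≢last (lemma i eq)
  where
  open import Data.Fin.Properties using (toℕ-injective; toℕ-fromℕ)
  open import Relation.Binary.PropositionalEquality using (sym; trans; cong)
  open import Data.Nat.Properties using (suc-injective)
  lemma : ∀ (j : Fin (suc m)) → suc m ≡ toℕ (suc j) → j ≡ fromℕ m
  lemma j eq = toℕ-injective (trans (sym (suc-injective eq)) (sym (toℕ-fromℕ m)))

Adjacent : ∀ {n} → OrientedGraph n → Fin n → Fin n → Set
Adjacent G u v = (arc G u v ≡ true) ⊎ (arc G v u ≡ true)

-- An ordered closed walk v_0 v_1 ... v_m v_0 of length k = suc m is a map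
-- w : Fin (suc m) → Fin n with consecutive (cyclically) vertices adjacent.
IsOrderedClosedWalk : ∀ {n m} → OrientedGraph n → (Fin (suc m) → Fin n) → Set
IsOrderedClosedWalk G w = ∀ i → Adjacent G (w i) (w (next i))

forwardCount : ∀ {n m} → OrientedGraph n → (Fin (suc m) → Fin n) → ℕ
forwardCount {m = m} G w =
  sum (map (λ i → if arc G (w i) (w (next i)) then 1 else 0) (allFinL (suc m)))

isOdd : ℕ → Bool
isOdd zero = false
isOdd (suc k) = if isOdd k then false else true

data Directability : Set where
  oddForward oddBackward evenDirectable evenNonDirectable : Directability

directability : ∀ {n m} → OrientedGraph n → (Fin (suc m) → Fin n) → Directability
directability {m = m} G w with isOdd (suc m) | isOdd (forwardCount G w)
... | true  | true  = oddForward
... | true  | false = oddBackward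
... | false | false = evenDirectable
... | false | true  = evenNonDirectable

PreservesDirectability : ∀ {n p m} → OrientedGraph n → OrientedGraph p →
                         (Fin n → Fin p) → (Fin (suc m) → Fin n) → Set
PreservesDirectability G H f w =
  IsOrderedClosedWalk H (λ i → f (w i)) × (directability H (λ i → f (w i)) ≡ directability G w)

-- Pushing S reverses the arc uv exactly when S u xor S v, so along a closed walk it changes
-- the number of forward arcs by the telescoping sum of S(vᵢ) xor S(vᵢ₊₁), which is even; a
-- homomorphism keeps every forward arc forward.  Conversely, sign each edge uv of G by whether f reverses it.  Preserving
-- directability says exactly that every closed walk has an even number of reversed edges, i.e.
-- this signed graph is balanced, so by Harary's theorem it has a potential S (S u xor S v is the
-- sign of uv), and f is a homomorphism of G pushed at S.
module Submission where

open import Defs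
open import Algebra.Bundles using (CommutativeRing)
open import Data.Bool using (Bool; true; false; not; _xor_; if_then_else_)
open import Data.Bool.Properties
  using (xor-assoc; xor-comm; xor-identityʳ; xor-same; true-xor; xor-∧-commutativeRing)
  renaming (_≟_ to _≟ᵇ_)
open import Data.Empty using (⊥-elim)
open import Data.Fin using (Fin; zero; suc; fromℕ; inject₁; lower₁; toℕ)
open import Data.Fin.Properties
  using (_≟_; any?; toℕ-injective; toℕ-fromℕ; fromℕ≢inject₁; lower₁-inject₁′; inject₁-lower₁)
open import Data.List using (map; tabulate; allFin)
open import Data.List.Properties using (map-tabulate)
open import Data.Nat using (ℕ; zero; suc)
import Data.Nat.ListAction as ℕ
open import Data.Product using (∃; _×_; _,_; proj₁; proj₂)
open import Data.Sum using (_⊎_; inj₁; inj₂; swap)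
open import Function using (_∘_; id; _⇔_; mk⇔; Equivalence)
open import Level using (0ℓ)
open import Relation.Binary.Core using (Rel)
open import Relation.Binary.Definitions using (Symmetric; Decidable)
open import Relation.Binary.Construct.Closure.ReflexiveTransitive
  using (Star; ε; _◅_; _◅◅_; kleisliStar)
open import Relation.Binary.PropositionalEquality
  using (_≡_; _≢_; refl; sym; trans; cong; cong₂; subst; module ≡-Reasoning)
open import Relation.Nullary using (Dec; yes; no)
open import Relation.Nullary.Decidable using (_⊎-dec_; _×-dec_)

open import Algebra.Properties.CommutativeMonoid.Sum
  (CommutativeRing.+-commutativeMonoid xor-∧-commutativeRing)
  using ()
  renaming (sum to parity; ∑-distrib-+ to parity-distrib-xor;
            sum-init-last to parity-init-last; sum-cong-≗ to parity-cong)

open Equivalence using (to; from)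

xor-cancelˡ : ∀ x y → x xor (x xor y) ≡ y
xor-cancelˡ x y = trans (sym (xor-assoc x x y)) (cong (_xor y) (xor-same x))

xor≡false⇔≡ : ∀ x y → x xor y ≡ false ⇔ x ≡ y
xor≡false⇔≡ x y = mk⇔ (to′ x y) (λ { refl → xor-same x })
  where
  to′ : ∀ x y → x xor y ≡ false → x ≡ y
  to′ true  true  _ = refl
  to′ false false _ = refl
  to′ true  false ()
  to′ false true  ()

xor-true : ∀ x → x xor true ≡ not x
xor-true x = trans (xor-comm x true) (true-xor x)

next-inject₁ : ∀ {m} (j : Fin m) → next (inject₁ j) ≡ suc j
next-inject₁ {m} j with inject₁ j ≟ fromℕ m
... | yes j≡last = ⊥-elim (fromℕ≢inject₁ (sym j≡last))
... | no _       = cong suc (lower₁-inject₁′ j _)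

next-fromℕ : ∀ m → next (fromℕ m) ≡ zero
next-fromℕ m with fromℕ m ≟ fromℕ m
... | yes _     = refl
... | no ¬refl = ⊥-elim (¬refl refl)

inject₁-or-fromℕ : ∀ {m} (i : Fin (suc m)) → (∃ λ j → inject₁ j ≡ i) ⊎ i ≡ fromℕ m
inject₁-or-fromℕ {m} i with i ≟ fromℕ m
... | yes i≡last = inj₂ i≡last
... | no i≢last  = inj₁ (lower₁ i m≢i , inject₁-lower₁ i m≢i)
  where
  m≢i : m ≢ toℕ i
  m≢i m≡i = i≢last (toℕ-injective (trans (sym m≡i) (sym (toℕ-fromℕ m))))

closed-next : ∀ {A : Set} {m} (a : Fin (suc (suc m)) → A) → a zero ≡ a (fromℕ (suc m)) →
              ∀ i → a (inject₁ (next i)) ≡ a (suc i)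
closed-next {m = m} a closed i with inject₁-or-fromℕ i
... | inj₁ (j , refl) = cong (a ∘ inject₁) (next-inject₁ j)
... | inj₂ refl       = trans (cong (a ∘ inject₁) (next-fromℕ m)) closed

parity-rotate : ∀ {m} (c : Fin (suc m) → Bool) → parity (c ∘ next) ≡ parity c
parity-rotate {m} c = begin
  parity (c ∘ next)
    ≡⟨ parity-init-last (c ∘ next) ⟩
  parity (c ∘ next ∘ inject₁) xor c (next (fromℕ m))
    ≡⟨ cong₂ _xor_ (parity-cong (λ j → cong c (next-inject₁ j))) (cong c (next-fromℕ m)) ⟩
  parity (c ∘ suc) xor c zero
    ≡⟨ xor-comm (parity (c ∘ suc)) (c zero) ⟩
  parity c
    ∎
  where open ≡-Reasoning

parity-telescope : ∀ {m} (c : Fin (suc m) → Bool) → parity (λ i → c i xor c (next i)) ≡ false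
parity-telescope c = begin
  parity (λ i → c i xor c (next i))   ≡⟨ parity-distrib-xor c (c ∘ next) ⟩
  parity c xor parity (c ∘ next)      ≡⟨ cong (parity c xor_) (parity-rotate c) ⟩
  parity c xor parity c               ≡⟨ xor-same (parity c) ⟩
  false                               ∎
  where open ≡-Reasoning

isOdd-suc : ∀ k → isOdd (suc k) ≡ not (isOdd k)
isOdd-suc k with isOdd k
... | true  = refl
... | false = refl

isOdd-countTrue : ∀ {m} (b : Fin m → Bool) →
                  isOdd (ℕ.sum (map (λ i → if b i then 1 else 0) (allFin m))) ≡ parity b
isOdd-countTrue {m} b =
  trans (cong (isOdd ∘ ℕ.sum) (map-tabulate id (λ i → if b i then 1 else 0))) (tabulated b)
  where
  tabulated : ∀ {m} (b : Fin m → Bool) →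
              isOdd (ℕ.sum (tabulate (λ i → if b i then 1 else 0))) ≡ parity b
  tabulated {zero}  b = refl
  tabulated {suc m} b with b zero
  ... | false = tabulated (b ∘ suc)
  ... | true  = trans (isOdd-suc (ℕ.sum (tabulate (λ i → if b (suc i) then 1 else 0))))
                      (cong not (tabulated (b ∘ suc)))

forwardParity : ∀ {k m} → OrientedGraph k → (Fin (suc m) → Fin k) → Bool
forwardParity K w = parity (λ i → arc K (w i) (w (next i)))

classify : Bool → Bool → Directability
classify true  true  = oddForward
classify true  false = oddBackward
classify false false = evenDirectable
classify false true  = evenNonDirectable

classify-injectiveʳ : ∀ c {x y} → classify c x ≡ classify c y → x ≡ y
classify-injectiveʳ true  {true}  {true}  _ = refl
classify-injectiveʳ true  {false} {false} _ = refl
classify-injectiveʳ false {true}  {true}  _ = refl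
classify-injectiveʳ false {false} {false} _ = refl
classify-injectiveʳ true  {true}  {false} ()
classify-injectiveʳ true  {false} {true}  ()
classify-injectiveʳ false {true}  {false} ()
classify-injectiveʳ false {false} {true}  ()

directability-classify : ∀ {k m} (K : OrientedGraph k) (w : Fin (suc m) → Fin k) →
                         directability K w ≡ classify (isOdd (suc m)) (forwardParity K w)
directability-classify {m = m} K w =
  trans by-cases
    (cong (classify (isOdd (suc m))) (isOdd-countTrue (λ i → arc K (w i) (w (next i)))))
  where
  by-cases : directability K w ≡ classify (isOdd (suc m)) (isOdd (forwardCount K w))
  by-cases with isOdd (suc m) | isOdd (forwardCount K w)
  ... | true  | true  = refl
  ... | true  | false = refl
  ... | false | false = refl
  ... | false | true  = refl

directability-≡⇔ : ∀ {k l m} (K : OrientedGraph k) (L : OrientedGraph l)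
                   (w : Fin (suc m) → Fin k) (w′ : Fin (suc m) → Fin l) →
                   directability K w ≡ directability L w′ ⇔ forwardParity K w ≡ forwardParity L w′
directability-≡⇔ {m = m} K L w w′ = mk⇔
  (λ eq → classify-injectiveʳ (isOdd (suc m))
            (trans (sym (directability-classify K w)) (trans eq (directability-classify L w′))))
  (λ eq → trans (directability-classify K w)
            (trans (cong (classify (isOdd (suc m))) eq) (sym (directability-classify L w′))))

arc-reverse : ∀ {k} (K : OrientedGraph k) {u v} → Adjacent K u v → arc K v u ≡ not (arc K u v)
arc-reverse K {u} {v} (inj₁ uv) rewrite uv = simple K u v uv
arc-reverse K {u} {v} (inj₂ vu) rewrite vu = sym (cong not (simple K v u vu))

hom-adjacent : ∀ {k l} (K : OrientedGraph k) (L : OrientedGraph l) (f : Fin k → Fin l) →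
               IsHomomorphism K L f → ∀ {u v} → Adjacent K u v → Adjacent L (f u) (f v)
hom-adjacent K L f hom (inj₁ uv) = inj₁ (hom _ _ uv)
hom-adjacent K L f hom (inj₂ vu) = inj₂ (hom _ _ vu)

hom-arc : ∀ {k l} (K : OrientedGraph k) (L : OrientedGraph l) (f : Fin k → Fin l) →
          IsHomomorphism K L f → ∀ {u v} → Adjacent K u v → arc L (f u) (f v) ≡ arc K u v
hom-arc K L f hom {u} {v} (inj₁ uv) = trans (hom u v uv) (sym uv)
hom-arc K L f hom {u} {v} (inj₂ vu) =
  trans (simple L _ _ (hom v u vu)) (sym (simple K v u vu))

push : ∀ {n} → OrientedGraph n → (Fin n → Bool) → OrientedGraph n
push G S = record { arc = pushArc G S ; loopless = loopless′ ; simple = simple′ }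
  where
  loopless′ : ∀ u → pushArc G S u u ≡ false
  loopless′ u rewrite xor-same (S u) = loopless G u
  simple′ : ∀ u v → pushArc G S u v ≡ true → pushArc G S v u ≡ false
  simple′ u v rewrite xor-comm (S v) (S u) with S u xor S v
  ... | false = simple G u v
  ... | true  = simple G v u

push-adjacent : ∀ {n} (G : OrientedGraph n) S u v → Adjacent (push G S) u v ⇔ Adjacent G u v
push-adjacent G S u v rewrite xor-comm (S v) (S u) with S u xor S v
... | false = mk⇔ id id
... | true  = mk⇔ swap swap

push-arc : ∀ {n} (G : OrientedGraph n) S {u v} → Adjacent G u v →
           arc (push G S) u v ≡ arc G u v xor (S u xor S v)
push-arc G S {u} {v} adj with S u xor S v
... | false = sym (xor-identityʳ (arc G u v))
... | true  = trans (arc-reverse G adj) (sym (xor-true (arc G u v)))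

Signing : ∀ {V : Set} → Rel V 0ℓ → Set
Signing E = ∀ {x y} → E x y → Bool

module _ {V : Set} {E : Rel V 0ℓ} where

  length : ∀ {x y} → Star E x y → ℕ
  length ε       = zero
  length (_ ◅ p) = suc (length p)

  vertexAt : ∀ {x y} (p : Star E x y) → Fin (suc (length p)) → V
  vertexAt {x} ε       _       = x
  vertexAt {x} (_ ◅ p) zero    = x
  vertexAt     (_ ◅ p) (suc i) = vertexAt p i

  vertexAt-last : ∀ {x y} (p : Star E x y) → vertexAt p (fromℕ (length p)) ≡ y
  vertexAt-last ε       = refl
  vertexAt-last (_ ◅ p) = vertexAt-last p

  edgeAt : ∀ {x y} (p : Star E x y) (i : Fin (length p)) →
           E (vertexAt p (inject₁ i)) (vertexAt p (suc i))
  edgeAt (e ◅ ε)     zero    = e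
  edgeAt (e ◅ _ ◅ _) zero    = e
  edgeAt (_ ◅ p)     (suc i) = edgeAt p i

  module _ (σ : Signing E) where

    sign : ∀ {x y} → Star E x y → Bool
    sign ε       = false
    sign (e ◅ p) = σ e xor sign p

    sign-◅◅ : ∀ {x y z} (p : Star E x y) (q : Star E y z) → sign (p ◅◅ q) ≡ sign p xor sign q
    sign-◅◅ ε       q = refl
    sign-◅◅ (e ◅ p) q =
      trans (cong (σ e xor_) (sign-◅◅ p q)) (sym (xor-assoc (σ e) (sign p) (sign q)))

    sign-edgeAt : ∀ {x y} (p : Star E x y) → sign p ≡ parity (σ ∘ edgeAt p)
    sign-edgeAt ε             = refl
    sign-edgeAt (e ◅ ε)       = refl
    sign-edgeAt (e ◅ e′ ◅ p) = cong (σ e xor_) (sign-edgeAt (e′ ◅ p))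

    Balanced : Set
    Balanced = ∀ {x} (p : Star E x x) → sign p ≡ false

    Potential : Set
    Potential = ∃ λ (S : V → Bool) → ∀ {x y} (e : E x y) → S x xor S y ≡ σ e

module VertexElimination {n} {E : Rel (Fin (suc n)) 0ℓ} (σ : Signing E) where

  E′ : Rel (Fin n) 0ℓ
  E′ u v = E (suc u) (suc v) ⊎ (E (suc u) zero × E zero (suc v))

  σ′ : Signing E′
  σ′ (inj₁ e)         = σ e
  σ′ (inj₂ (e₁ , e₂)) = σ e₁ xor σ e₂

  expand : ∀ {u v} → E′ u v → Star E (suc u) (suc v)
  expand (inj₁ e)         = e ◅ ε
  expand (inj₂ (e₁ , e₂)) = e₁ ◅ e₂ ◅ ε

  sign-expand : ∀ {u v} (e : E′ u v) → sign σ (expand e) ≡ σ′ e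
  sign-expand (inj₁ e)         = xor-identityʳ (σ e)
  sign-expand (inj₂ (e₁ , e₂)) = cong (σ e₁ xor_) (xor-identityʳ (σ e₂))

  lift : ∀ {u v} → Star E′ u v → Star E (suc u) (suc v)
  lift = kleisliStar suc expand

  sign-lift : ∀ {u v} (p : Star E′ u v) → sign σ (lift p) ≡ sign σ′ p
  sign-lift ε       = refl
  sign-lift (e ◅ p) =
    trans (sign-◅◅ σ (expand e) (lift p)) (cong₂ _xor_ (sign-expand e) (sign-lift p))

  symmetric′ : Symmetric E → Symmetric E′
  symmetric′ E-sym (inj₁ e)         = inj₁ (E-sym e)
  symmetric′ E-sym (inj₂ (e₁ , e₂)) = inj₂ (E-sym e₂ , E-sym e₁)

  decidable′ : Decidable E → Decidable E′
  decidable′ E? u v = E? (suc u) (suc v) ⊎-dec (E? (suc u) zero ×-dec E? zero (suc v))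

  balanced′ : Balanced σ → Balanced σ′
  balanced′ balanced p = trans (sym (sign-lift p)) (balanced (lift p))

-- Harary's balance theorem: eliminate vertex zero, routing each path u – 0 – v through a
-- new edge u – v, and give 0 the value that makes its edge to one chosen neighbour correct.
balanced⇒potential : ∀ n {E : Rel (Fin n) 0ℓ} (σ : Signing E) →
                     Symmetric E → Decidable E → Balanced {E = E} σ → Potential {E = E} σ
balanced⇒potential zero    σ _     _  _        = (λ ()) , λ { {()} }
balanced⇒potential (suc n) {E} σ E-sym E? balanced = S , S-correct
  where
  open VertexElimination σ
  open ≡-Reasoning

  potential′ : Potential σ′
  potential′ = balanced⇒potential n σ′ (symmetric′ E-sym) (decidable′ E?) (balanced′ balanced)

  S′ : Fin n → Bool
  S′ = proj₁ potential′

  S′-correct : ∀ {u v} (e : E′ u v) → S′ u xor S′ v ≡ σ′ e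
  S′-correct = proj₂ potential′

  σ-loop : ∀ {x} (e : E x x) → σ e ≡ false
  σ-loop e = trans (sym (xor-identityʳ (σ e))) (balanced (e ◅ ε))

  σ-sym : ∀ {x y} (e : E x y) → σ (E-sym e) ≡ σ e
  σ-sym e = sym (to (xor≡false⇔≡ (σ e) (σ (E-sym e)))
    (trans (cong (σ e xor_) (sym (xor-identityʳ (σ (E-sym e))))) (balanced (e ◅ E-sym e ◅ ε))))

  neighbour₀? : Dec (∃ λ u → E zero (suc u))
  neighbour₀? = any? (λ u → E? zero (suc u))

  value₀ : Dec (∃ λ u → E zero (suc u)) → Bool
  value₀ (yes (u , e)) = σ e xor S′ u
  value₀ (no _)        = false

  S : Fin (suc n) → Bool
  S zero    = value₀ neighbour₀?
  S (suc u) = S′ u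

  value₀-correct : ∀ d {v} (e : E zero (suc v)) → value₀ d xor S′ v ≡ σ e
  value₀-correct (no ∄)         e = ⊥-elim (∄ (_ , e))
  value₀-correct (yes (u , e₀)) {v} e = begin
    (σ e₀ xor S′ u) xor S′ v        ≡⟨ xor-assoc (σ e₀) (S′ u) (S′ v) ⟩
    σ e₀ xor (S′ u xor S′ v)        ≡⟨ cong (σ e₀ xor_) (S′-correct (inj₂ (E-sym e₀ , e))) ⟩
    σ e₀ xor (σ (E-sym e₀) xor σ e) ≡⟨ cong (λ s → σ e₀ xor (s xor σ e)) (σ-sym e₀) ⟩
    σ e₀ xor (σ e₀ xor σ e)         ≡⟨ xor-cancelˡ (σ e₀) (σ e) ⟩
    σ e                             ∎

  S-correct : ∀ {x y} (e : E x y) → S x xor S y ≡ σ e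
  S-correct {zero}  {zero}  e = trans (xor-same (S zero)) (sym (σ-loop e))
  S-correct {zero}  {suc v} e = value₀-correct neighbour₀? e
  S-correct {suc u} {zero}  e =
    trans (xor-comm (S′ u) (S zero)) (trans (value₀-correct neighbour₀? (E-sym e)) (σ-sym e))
  S-correct {suc u} {suc v} e = S′-correct (inj₁ e)

hom-preserves-directability :
  ∀ {k l m} (K : OrientedGraph k) (L : OrientedGraph l) (f : Fin k → Fin l) → IsHomomorphism K L f →
  {w : Fin (suc m) → Fin k} → IsOrderedClosedWalk K w → directability L (f ∘ w) ≡ directability K w
hom-preserves-directability K L f hom {w} walk =
  from (directability-≡⇔ L K (f ∘ w) w) (parity-cong (λ i → hom-arc K L f hom (walk i)))

push-preserves-directability :
  ∀ {n m} (G : OrientedGraph n) S {w : Fin (suc m) → Fin n} →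
  IsOrderedClosedWalk G w → directability (push G S) w ≡ directability G w
push-preserves-directability G S {w} walk = from (directability-≡⇔ (push G S) G w w) (begin
  parity (λ i → arc (push G S) (w i) (w (next i)))
    ≡⟨ parity-cong (λ i → push-arc G S (walk i)) ⟩
  parity (λ i → arc G (w i) (w (next i)) xor (s i xor s (next i)))
    ≡⟨ parity-distrib-xor (λ i → arc G (w i) (w (next i))) (λ i → s i xor s (next i)) ⟩
  forwardParity G w xor parity (λ i → s i xor s (next i))
    ≡⟨ cong (forwardParity G w xor_) (parity-telescope s) ⟩
  forwardParity G w xor false
    ≡⟨ xor-identityʳ (forwardParity G w) ⟩
  forwardParity G w
    ∎)
  where
  open ≡-Reasoning
  s : Fin _ → Bool
  s = S ∘ w

module _ {n p} (G : OrientedGraph n) (H : OrientedGraph p) (f : Fin n → Fin p) where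

  PreservesAllDirectabilities : Set
  PreservesAllDirectabilities =
    ∀ (m : ℕ) (w : Fin (suc m) → Fin n) → IsOrderedClosedWalk G w → PreservesDirectability G H f w

  pushable⇒preserves : IsPushableHomomorphism G H f → PreservesAllDirectabilities
  pushable⇒preserves (S , hom) m w walk =
    hom-adjacent (push G S) H f hom ∘ walk′ ,
    trans (hom-preserves-directability (push G S) H f hom walk′) (push-preserves-directability G S walk)
    where
    walk′ : IsOrderedClosedWalk (push G S) w
    walk′ i = from (push-adjacent G S (w i) (w (next i))) (walk i)

  mismatch : Fin n → Fin n → Bool
  mismatch u v = arc G u v xor arc H (f u) (f v)

  mismatchSigning : Signing (Adjacent G)
  mismatchSigning {u} {v} _ = mismatch u v

  mismatch-parity : ∀ {m} {w : Fin (suc m) → Fin n} → PreservesDirectability G H f w →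
                    parity (λ i → mismatch (w i) (w (next i))) ≡ false
  mismatch-parity {w = w} (_ , same) =
    trans (parity-distrib-xor (λ i → arc G (w i) (w (next i))) (λ i → arc H (f (w i)) (f (w (next i)))))
          (from (xor≡false⇔≡ (forwardParity G w) (forwardParity H (f ∘ w)))
                (sym (to (directability-≡⇔ H G (f ∘ w) w) same)))

  preserves⇒balanced : PreservesAllDirectabilities → Balanced {E = Adjacent G} mismatchSigning
  preserves⇒balanced preserves ε         = refl
  preserves⇒balanced preserves p@(_ ◅ q) = begin
    sign mismatchSigning p
      ≡⟨ sign-edgeAt mismatchSigning p ⟩
    parity (λ i → mismatch (w i) (vertexAt p (suc i)))
      ≡⟨ parity-cong (λ i → cong (mismatch (w i)) (sym (closed i))) ⟩
    parity (λ i → mismatch (w i) (w (next i)))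
      ≡⟨ mismatch-parity (preserves (length q) w walk) ⟩
    false
      ∎
    where
    open ≡-Reasoning
    w : Fin (length p) → Fin n
    w = vertexAt p ∘ inject₁
    closed : ∀ i → w (next i) ≡ vertexAt p (suc i)
    closed = closed-next (vertexAt p) (sym (vertexAt-last p))
    walk : IsOrderedClosedWalk G w
    walk i = subst (Adjacent G (w i)) (sym (closed i)) (edgeAt p i)

  preserves⇒pushable : PreservesAllDirectabilities → IsPushableHomomorphism G H f
  preserves⇒pushable preserves = S , hom
    where
    open ≡-Reasoning
    adjacent? : Decidable (Adjacent G)
    adjacent? u v = (arc G u v ≟ᵇ true) ⊎-dec (arc G v u ≟ᵇ true)
    potential : Potential {E = Adjacent G} mismatchSigning
    potential = balanced⇒potential n mismatchSigning swap adjacent? (preserves⇒balanced preserves)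
    S : Fin n → Bool
    S = proj₁ potential
    hom : IsHomomorphism (push G S) H f
    hom u v uv = begin
      arc H (f u) (f v)          ≡⟨ sym (xor-cancelˡ (arc G u v) (arc H (f u) (f v))) ⟩
      arc G u v xor mismatch u v  ≡⟨ cong (arc G u v xor_) (sym (proj₂ potential adjacent)) ⟩
      arc G u v xor (S u xor S v) ≡⟨ sym (push-arc G S adjacent) ⟩
      arc (push G S) u v          ≡⟨ uv ⟩
      true                        ∎
      where adjacent = to (push-adjacent G S u v) (inj₁ uv)

mainTheorem3 : ∀ {n p} (G : OrientedGraph n) (H : OrientedGraph p) (f : Fin n → Fin p) →
    IsPushableHomomorphism G H f ⇔
      (∀ (m : ℕ) (w : Fin (suc m) → Fin n) → IsOrderedClosedWalk G w → PreservesDirectability G H f w)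
mainTheorem3 G H f = mk⇔ (pushable⇒preserves G H f) (preserves⇒pushable G H f)
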